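{- For all positive integers $n$ and $k$ there is an integer $D(n,k)$ such that for every unary linear program $Z$ with at most $n$ variables the following holds: if $\operatorname{OPT}(Z)>k$, then $\operatorname{OPT}(Z)-k>\frac{1}{D(n,k)}$.
   Context: A unary linear program with $n$ variables is a linear program of the form: minimize $c^T x$ subject to $Ax\geq b$ and $x\geq 0$, where $x$ is a vector of $n$ real variables, $c=(1,\dots,1)\in\{1\}^n$, $b=(1,\dots,1)\in\{1\}^m$ and $A\in\{0,1\}^{m\times n}$ for some $m$. $\operatorname{OPT}(Z)$ denotes the minimum (optimal value) of the linear program $Z$.
   Formalization: The variables $x$ of each unary linear program, and hence $\operatorname{OPT}(Z)$, take values in ℚ instead of the reals. -}

module Defs where

open import Data.Nat using (ℕ; zero; suc)
open import Data.Fin using (Fin)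
open import Data.Bool using (Bool; true; false)
open import Data.Integer using (+_)
open import Data.Rational using (ℚ; 0ℚ; 1ℚ; _+_; _*_; _≤_; _/_)
open import Data.Product using (Σ; _×_)
open import Relation.Binary.PropositionalEquality using (_≡_)

Σᶠ : (n : ℕ) → (Fin n → ℚ) → ℚ
Σᶠ zero    f = 0ℚ
Σᶠ (suc n) f = f Fin.zero + Σᶠ n (λ i → f (Fin.suc i))
  where import Data.Fin as Fin

bit : Bool → ℚ
bit true  = 1ℚ
bit false = 0ℚ

-- A unary linear program with n variables and m constraints:
-- minimize Σ x_j  subject to  A x ≥ 1,  x ≥ 0,  where A ∈ {0,1}^{m×n}.
record UnaryLP (n : ℕ) : Set where
  field
    m : ℕ
    A : Fin m → Fin n → Bool

open UnaryLP public

objective : {n : ℕ} → (Fin n → ℚ) → ℚ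
objective {n} x = Σᶠ n x

Feasible : {n : ℕ} → UnaryLP n → (Fin n → ℚ) → Set
Feasible {n} Z x =
  ((j : Fin n) → 0ℚ ≤ x j) ×
  ((i : Fin (m Z)) → 1ℚ ≤ Σᶠ n (λ j → bit (A Z i j) * x j))

IsOPT : {n : ℕ} → UnaryLP n → ℚ → Set
IsOPT {n} Z v =
  Σ (Fin n → ℚ) (λ x → Feasible Z x × objective x ≡ v)
  × ((y : Fin n → ℚ) → Feasible Z y → v ≤ objective y)

{-# OPTIONS --safe #-}
-- "OPT(Z) ≤ k" is the feasibility of the integer system  -Σ xⱼ ≥ -k,  A x ≥ 1,  x ≥ 0,
-- whose coefficients are bounded by k. Fourier–Motzkin elimination of a variable adds, for
-- every pair of constraints whose leading coefficients have opposite signs, the positive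
-- combination cancelling that variable. If a system with coefficients bounded by N holds up
-- to a slack δ, the eliminated system has coefficients bounded by 2N² and holds up to
-- (2N+1)δ; conversely an exact solution of the eliminated system extends to the original one
-- by choosing the eliminated variable between its lower and upper bounds. Once all variables
-- are gone each constraint reads b ≤ slack with b an integer, so a slack below 1 forces b ≤ 0.
-- Hence OPT(Z) ≤ k + δ with δ·D(n,k) < 1, where D(0,N) = 1 and D(n+1,N) = (2N+1)·D(n,2N²),
-- already implies OPT(Z) ≤ k, and δ = 1/(D(n,k)+1) gives the gap.
module Submission where

open import Defs
open import Data.Nat as ℕ using (ℕ; zero; suc; z≤n; s≤s)
import Data.Nat.Properties as ℕ
open import Data.Integer as ℤ using (ℤ; +_; +0; +[1+_]; -[1+_]; -1ℤ)
import Data.Integer.Properties as ℤ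
open import Data.Rational as ℚ
  using (ℚ; 0ℚ; 1ℚ; _/_; _+_; _*_; -_; _-_; _≤_; _<_; toℚᵘ; NonNegative; Positive)
open import Data.Rational.Properties
import Data.Rational.Unnormalised as ℚᵘ
import Data.Rational.Unnormalised.Properties as ℚᵘ
open import Data.Rational.Solver using (module +-*-Solver)
open import Algebra.Bundles using (Ring)
open import Algebra.Properties.Semiring.Sum (Ring.semiring +-*-ring)
  using (sum; sum-cong-≗; ∑-distrib-+; *-distribˡ-sum)
open import Algebra.Properties.Group +-0-group using (⁻¹-involutive)
open import Data.Bool using (Bool; true; false)
open import Data.Fin using (Fin; zero; suc)
open import Data.Vec.Functional using () renaming (_∷_ to _∷ᵛ_)
open import Data.List using (List; []; _∷_; _++_; foldr; map; tabulate; cartesianProductWith)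
open import Data.List.Relation.Unary.All as All using (All; []; _∷_)
import Data.List.Relation.Unary.All.Properties as All
open import Data.List.Membership.Propositional using (_∈_)
open import Data.List.Membership.Propositional.Properties using (∈-cartesianProductWith⁺)
open import Relation.Binary.Bundles using (DecTotalOrder)
open import Data.List.Extrema (DecTotalOrder.totalOrder ≤-decTotalOrder)
  using (max; min; xs≤max; max≤v⁺; min≤xs)
open import Data.Product using (Σ; ∃-syntax; _×_; _,_; proj₁; proj₂)
open import Data.Sum using (inj₁; inj₂)
open import Function using (_∘_)
open import Relation.Binary.PropositionalEquality
open import Relation.Nullary using (contradiction)

open +-*-Solver using (solve; _:=_; _:+_; _:*_; :-_; _:-_)

ι : ℤ → ℚ
ι i = i / 1

private
  toℚᵘ-ι : ∀ i → toℚᵘ (ι i) ℚᵘ.≃ ℚᵘ.mkℚᵘ i 0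
  toℚᵘ-ι i = toℚᵘ-fromℚᵘ (ℚᵘ.mkℚᵘ i 0)

ι-+ : ∀ i j → ι (i ℤ.+ j) ≡ ι i + ι j
ι-+ i j = toℚᵘ-injective (begin
  toℚᵘ (ι (i ℤ.+ j))             ≈⟨ toℚᵘ-ι (i ℤ.+ j) ⟩
  ℚᵘ.mkℚᵘ (i ℤ.+ j) 0            ≈⟨ ℚᵘ.*≡* eq ⟩
  ℚᵘ.mkℚᵘ i 0 ℚᵘ.+ ℚᵘ.mkℚᵘ j 0   ≈⟨ ℚᵘ.+-cong (toℚᵘ-ι i) (toℚᵘ-ι j) ⟨
  toℚᵘ (ι i) ℚᵘ.+ toℚᵘ (ι j)     ≈⟨ toℚᵘ-homo-+ (ι i) (ι j) ⟨
  toℚᵘ (ι i + ι j)               ∎)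
  where
  open ℚᵘ.≃-Reasoning
  eq : (i ℤ.+ j) ℤ.* + 1 ≡ (i ℤ.* + 1 ℤ.+ j ℤ.* + 1) ℤ.* + 1
  eq = cong (ℤ._* + 1) (sym (cong₂ ℤ._+_ (ℤ.*-identityʳ i) (ℤ.*-identityʳ j)))

ι-* : ∀ i j → ι (i ℤ.* j) ≡ ι i * ι j
ι-* i j = toℚᵘ-injective (begin
  toℚᵘ (ι (i ℤ.* j))             ≈⟨ toℚᵘ-ι (i ℤ.* j) ⟩
  ℚᵘ.mkℚᵘ (i ℤ.* j) 0            ≈⟨ ℚᵘ.*-cong (toℚᵘ-ι i) (toℚᵘ-ι j) ⟨
  toℚᵘ (ι i) ℚᵘ.* toℚᵘ (ι j)     ≈⟨ toℚᵘ-homo-* (ι i) (ι j) ⟨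
  toℚᵘ (ι i * ι j)               ∎)
  where open ℚᵘ.≃-Reasoning

ι-mono-≤ : ∀ {i j} → i ℤ.≤ j → ι i ≤ ι j
ι-mono-≤ {i} {j} i≤j = toℚᵘ-cancel-≤ (begin
  toℚᵘ (ι i)     ≃⟨ toℚᵘ-ι i ⟩
  ℚᵘ.mkℚᵘ i 0    ≤⟨ ℚᵘ.*≤* (ℤ.*-monoʳ-≤-nonNeg (+ 1) i≤j) ⟩
  ℚᵘ.mkℚᵘ j 0    ≃⟨ toℚᵘ-ι j ⟨
  toℚᵘ (ι j)     ∎)
  where open ℚᵘ.≤-Reasoning

ι-mono-< : ∀ {i j} → i ℤ.< j → ι i < ι j
ι-mono-< {i} {j} i<j = toℚᵘ-cancel-< (begin-strict
  toℚᵘ (ι i)     ≃⟨ toℚᵘ-ι i ⟩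
  ℚᵘ.mkℚᵘ i 0    <⟨ ℚᵘ.*<* (ℤ.*-monoʳ-<-pos (+ 1) i<j) ⟩
  ℚᵘ.mkℚᵘ j 0    ≃⟨ toℚᵘ-ι j ⟨
  toℚᵘ (ι j)     ∎)
  where open ℚᵘ.≤-Reasoning

i/n*n≡i : ∀ i n → (i / suc n) * ι (+ suc n) ≡ ι i
i/n*n≡i i n = toℚᵘ-injective (begin
  toℚᵘ ((i / suc n) * ι (+ suc n))
    ≈⟨ toℚᵘ-homo-* (i / suc n) (ι (+ suc n)) ⟩
  toℚᵘ (i / suc n) ℚᵘ.* toℚᵘ (ι (+ suc n))
    ≈⟨ ℚᵘ.*-cong (toℚᵘ-fromℚᵘ (ℚᵘ.mkℚᵘ i n)) (toℚᵘ-ι (+ suc n)) ⟩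
  ℚᵘ.mkℚᵘ i n ℚᵘ.* ℚᵘ.mkℚᵘ (+ suc n) 0
    ≈⟨ ℚᵘ.*≡* eq ⟩
  ℚᵘ.mkℚᵘ i 0
    ≈⟨ toℚᵘ-ι i ⟨
  toℚᵘ (ι i) ∎)
  where
  open ℚᵘ.≃-Reasoning
  eq : (i ℤ.* + suc n) ℤ.* + 1 ≡ i ℤ.* + (suc n ℕ.* 1)
  eq = trans (ℤ.*-identityʳ _) (cong (λ m → i ℤ.* + m) (sym (ℕ.*-identityʳ (suc n))))

ι-combination : ∀ k i l j → ι (+ k ℤ.* i ℤ.+ + l ℤ.* j) ≡ ι (+ k) * ι i + ι (+ l) * ι j
ι-combination k i l j = trans (ι-+ (+ k ℤ.* i) (+ l ℤ.* j)) (cong₂ _+_ (ι-* (+ k) i) (ι-* (+ l) j))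

ι-neg : ∀ k → ι (ℤ.- + k) ≡ - ι (+ k)
ι-neg zero    = refl
ι-neg (suc k) = refl

ι<1⇒ι≤0 : ∀ i → ι i < 1ℚ → ι i ≤ 0ℚ
ι<1⇒ι≤0 +0       _   = ≤-refl
ι<1⇒ι≤0 +[1+ n ] ι<1 =
  contradiction (<-≤-trans ι<1 (ι-mono-≤ {+ 1} {+[1+ n ]} (ℤ.+≤+ (s≤s z≤n)))) (<-irrefl refl)
ι<1⇒ι≤0 -[1+ n ] _   = ι-mono-≤ { -[1+ n ]} {+0} ℤ.-≤+

ι-nonNeg : ∀ k → NonNegative (ι (+ k))
ι-nonNeg k = normalize-nonNeg k 1

ι-pos : ∀ k → Positive (ι (+ suc k))
ι-pos k = normalize-pos (suc k) 1

ι-*-monoˡ-≤ : ∀ k {p q} → p ≤ q → ι (+ k) * p ≤ ι (+ k) * q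
ι-*-monoˡ-≤ k = *-monoˡ-≤-nonNeg (ι (+ k)) {{ι-nonNeg k}}

scale-mono-≤ : ∀ {δ} → 0ℚ ≤ δ → ∀ {m m′} → m ℕ.≤ m′ → ι (+ m) * δ ≤ ι (+ m′) * δ
scale-mono-≤ {δ} δ≥0 m≤m′ = *-monoʳ-≤-nonNeg δ {{ℚ.nonNegative δ≥0}} (ι-mono-≤ (ℤ.+≤+ m≤m′))

*-/-cancel : ∀ p r → ι (+ suc p) * (r * (+ 1 / suc p)) ≡ r
*-/-cancel p r = begin
  P * (r * P⁻¹)  ≡⟨ solve 3 (λ P r I → P :* (r :* I) := r :* (I :* P)) refl P r P⁻¹ ⟩
  r * (P⁻¹ * P)  ≡⟨ cong (r *_) (i/n*n≡i (+ 1) p) ⟩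
  r * 1ℚ         ≡⟨ *-identityʳ r ⟩
  r              ∎
  where
  open ≡-Reasoning
  P = ι (+ suc p)
  P⁻¹ = + 1 / suc p

≤-cross-/ : ∀ p q {r s} → ι (+ suc q) * r ≤ ι (+ suc p) * s →
  r * (+ 1 / suc p) ≤ s * (+ 1 / suc q)
≤-cross-/ p q {r} {s} Qr≤Ps = *-cancelˡ-≤-pos (P * Q) {{pos*pos⇒pos P {{ι-pos p}} Q {{ι-pos q}}}} (begin
  P * Q * (r * P⁻¹)
    ≡⟨ solve 4 (λ P Q r I → P :* Q :* (r :* I) := Q :* (P :* (r :* I))) refl P Q r P⁻¹ ⟩
  Q * (P * (r * P⁻¹))
    ≡⟨ cong (Q *_) (*-/-cancel p r) ⟩
  Q * r
    ≤⟨ Qr≤Ps ⟩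
  P * s
    ≡⟨ cong (P *_) (*-/-cancel q s) ⟨
  P * (Q * (s * Q⁻¹))
    ≡⟨ solve 4 (λ P Q s I → P :* (Q :* (s :* I)) := P :* Q :* (s :* I)) refl P Q s Q⁻¹ ⟩
  P * Q * (s * Q⁻¹) ∎)
  where
  open ≤-Reasoning
  P = ι (+ suc p)
  Q = ι (+ suc q)
  P⁻¹ = + 1 / suc p
  Q⁻¹ = + 1 / suc q

1/[1+d]*m<1 : ∀ {m d} → m ℕ.≤ d → (+ 1 / suc d) * ι (+ m) < 1ℚ
1/[1+d]*m<1 {m} {d} m≤d = subst ((+ 1 / suc d) * ι (+ m) <_) (i/n*n≡i (+ 1) d)
  (*-monoʳ-<-pos (+ 1 / suc d) {{normalize-pos 1 (suc d)}} (ι-mono-< (ℤ.+<+ (s≤s m≤d))))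

p-q≤r⇒p≤q+r : ∀ {p q r} → p - q ≤ r → p ≤ q + r
p-q≤r⇒p≤q+r {p} {q} {r} p-q≤r = begin
  p            ≡⟨ solve 2 (λ p q → p := q :+ (p :- q)) refl p q ⟩
  q + (p - q)  ≤⟨ +-monoʳ-≤ q p-q≤r ⟩
  q + r        ∎
  where open ≤-Reasoning

∃-between : ∀ (ls us : List ℚ) → All (λ l → All (l ≤_) us) ls →
  ∃[ x ] All (_≤ x) ls × All (x ≤_) us
∃-between ls us ls≤us = max (min 0ℚ us) ls , xs≤max (min 0ℚ us) ls ,
  All.tabulate (λ u∈us → max≤v⁺ (All.lookup (min≤xs 0ℚ us) u∈us)
                                (All.map (λ l≤us → All.lookup l≤us u∈us) ls≤us))

Σᶠ≡sum : ∀ n (f : Fin n → ℚ) → Σᶠ n f ≡ sum f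
Σᶠ≡sum zero    f = refl
Σᶠ≡sum (suc n) f = cong (_+_ (f zero)) (Σᶠ≡sum n (f ∘ suc))

Σᶠ-cong : ∀ n {f g : Fin n → ℚ} → (∀ j → f j ≡ g j) → Σᶠ n f ≡ Σᶠ n g
Σᶠ-cong n {f} {g} f≗g = begin
  Σᶠ n f  ≡⟨ Σᶠ≡sum n f ⟩
  sum f   ≡⟨ sum-cong-≗ f≗g ⟩
  sum g   ≡⟨ Σᶠ≡sum n g ⟨
  Σᶠ n g  ∎
  where open ≡-Reasoning

Σᶠ-distrib-+ : ∀ n (f g : Fin n → ℚ) → Σᶠ n (λ j → f j + g j) ≡ Σᶠ n f + Σᶠ n g
Σᶠ-distrib-+ n f g = begin
  Σᶠ n (λ j → f j + g j)  ≡⟨ Σᶠ≡sum n _ ⟩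
  sum (λ j → f j + g j)   ≡⟨ ∑-distrib-+ f g ⟩
  sum f + sum g           ≡⟨ cong₂ _+_ (Σᶠ≡sum n f) (Σᶠ≡sum n g) ⟨
  Σᶠ n f + Σᶠ n g         ∎
  where open ≡-Reasoning

*-distribˡ-Σᶠ : ∀ n r (f : Fin n → ℚ) → r * Σᶠ n f ≡ Σᶠ n (λ j → r * f j)
*-distribˡ-Σᶠ n r f = begin
  r * Σᶠ n f              ≡⟨ cong (r *_) (Σᶠ≡sum n f) ⟩
  r * sum f               ≡⟨ *-distribˡ-sum r f ⟩
  sum (λ j → r * f j)     ≡⟨ Σᶠ≡sum n _ ⟨
  Σᶠ n (λ j → r * f j)    ∎
  where open ≡-Reasoning

-- Linear constraints with integer coefficients

infix 5 _≥ᶜ_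
infix 4 _⊨_ _⊨[_]_

record Constraint (n : ℕ) : Set where
  constructor _≥ᶜ_
  field
    coeffs : Fin n → ℤ
    rhs    : ℤ
open Constraint

_·_ : ∀ {n} → (Fin n → ℤ) → (Fin n → ℚ) → ℚ
_·_ {n} a x = Σᶠ n (λ j → ι (a j) * x j)

_⊨_ : ∀ {n} → (Fin n → ℚ) → Constraint n → Set
x ⊨ (a ≥ᶜ b) = ι b ≤ a · x

_⊨[_]_ : ∀ {n} → (Fin n → ℚ) → ℚ → Constraint n → Set
x ⊨[ δ ] (a ≥ᶜ b) = ι b ≤ a · x + δ

Bounded : ∀ {n} → ℕ → Constraint n → Set
Bounded N (a ≥ᶜ b) = (∀ j → ℤ.∣ a j ∣ ℕ.≤ N) × ℤ.∣ b ∣ ℕ.≤ N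

⊨⇒⊨[] : ∀ {n δ} {x : Fin n → ℚ} c → 0ℚ ≤ δ → x ⊨ c → x ⊨[ δ ] c
⊨⇒⊨[] {δ = δ} {x} (a ≥ᶜ b) δ≥0 sat =
  ≤-trans sat (subst (_≤ a · x + δ) (+-identityʳ (a · x)) (+-monoʳ-≤ (a · x) δ≥0))

⊨[]-mono : ∀ {n δ δ′} {x : Fin n → ℚ} c → δ ≤ δ′ → x ⊨[ δ ] c → x ⊨[ δ′ ] c
⊨[]-mono {x = x} (a ≥ᶜ b) δ≤δ′ sat = ≤-trans sat (+-monoʳ-≤ (a · x) δ≤δ′)

Bounded-mono : ∀ {n N M} (c : Constraint n) → N ℕ.≤ M → Bounded N c → Bounded M c
Bounded-mono (a ≥ᶜ b) N≤M (a≤N , b≤N) = (λ j → ℕ.≤-trans (a≤N j) N≤M) , ℕ.≤-trans b≤N N≤M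

combine : ∀ {n} → ℕ → Constraint n → ℕ → Constraint n → Constraint n
combine k (a ≥ᶜ b) l (a′ ≥ᶜ b′) =
  (λ j → + k ℤ.* a j ℤ.+ + l ℤ.* a′ j) ≥ᶜ (+ k ℤ.* b ℤ.+ + l ℤ.* b′)

·-combine : ∀ {n} k (a : Fin n → ℤ) l a′ x →
  (λ j → + k ℤ.* a j ℤ.+ + l ℤ.* a′ j) · x ≡ ι (+ k) * (a · x) + ι (+ l) * (a′ · x)
·-combine {n} k a l a′ x = begin
  (λ j → + k ℤ.* a j ℤ.+ + l ℤ.* a′ j) · x
    ≡⟨ Σᶠ-cong n termwise ⟩
  Σᶠ n (λ j → K * (ι (a j) * x j) + L * (ι (a′ j) * x j))
    ≡⟨ Σᶠ-distrib-+ n _ _ ⟩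
  Σᶠ n (λ j → K * (ι (a j) * x j)) + Σᶠ n (λ j → L * (ι (a′ j) * x j))
    ≡⟨ cong₂ _+_ (*-distribˡ-Σᶠ n K _) (*-distribˡ-Σᶠ n L _) ⟨
  K * (a · x) + L * (a′ · x) ∎
  where
  open ≡-Reasoning
  K = ι (+ k)
  L = ι (+ l)
  termwise : ∀ j → ι (+ k ℤ.* a j ℤ.+ + l ℤ.* a′ j) * x j ≡ K * (ι (a j) * x j) + L * (ι (a′ j) * x j)
  termwise j = trans (cong (_* x j) (ι-combination k (a j) l (a′ j)))
    (solve 5 (λ K A L A′ X → (K :* A :+ L :* A′) :* X := K :* (A :* X) :+ L :* (A′ :* X)) refl
      K (ι (a j)) L (ι (a′ j)) (x j))

∣combination∣≤ : ∀ {N k l i j} → k ℕ.≤ N → l ℕ.≤ N → ℤ.∣ i ∣ ℕ.≤ N → ℤ.∣ j ∣ ℕ.≤ N →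
  ℤ.∣ + k ℤ.* i ℤ.+ + l ℤ.* j ∣ ℕ.≤ N ℕ.* N ℕ.+ N ℕ.* N
∣combination∣≤ {N} {k} {l} {i} {j} k≤N l≤N i≤N j≤N = begin
  ℤ.∣ + k ℤ.* i ℤ.+ + l ℤ.* j ∣          ≤⟨ ℤ.∣i+j∣≤∣i∣+∣j∣ (+ k ℤ.* i) (+ l ℤ.* j) ⟩
  ℤ.∣ + k ℤ.* i ∣ ℕ.+ ℤ.∣ + l ℤ.* j ∣    ≡⟨ cong₂ ℕ._+_ (ℤ.abs-* (+ k) i) (ℤ.abs-* (+ l) j) ⟩
  k ℕ.* ℤ.∣ i ∣ ℕ.+ l ℕ.* ℤ.∣ j ∣        ≤⟨ ℕ.+-mono-≤ (ℕ.*-mono-≤ k≤N i≤N) (ℕ.*-mono-≤ l≤N j≤N) ⟩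
  N ℕ.* N ℕ.+ N ℕ.* N                    ∎
  where open ℕ.≤-Reasoning

combine-bounded : ∀ {n N k l} {c d : Constraint n} → k ℕ.≤ N → l ℕ.≤ N →
  Bounded N c → Bounded N d → Bounded (N ℕ.* N ℕ.+ N ℕ.* N) (combine k c l d)
combine-bounded {c = a ≥ᶜ b} {a′ ≥ᶜ b′} k≤N l≤N (a≤N , b≤N) (a′≤N , b′≤N) =
  (λ j → ∣combination∣≤ k≤N l≤N (a≤N j) (a′≤N j)) , ∣combination∣≤ k≤N l≤N b≤N b′≤N

-- Fourier–Motzkin elimination of the first variable

lead : ∀ {n} → Constraint (suc n) → ℤ
lead c = coeffs c zero

rest : ∀ {n} → Constraint (suc n) → Constraint n
rest c = coeffs c ∘ suc ≥ᶜ rhs c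

infixr 5 _◃_

_◃_ : ∀ {n} → ℤ → Constraint n → Constraint (suc n)
h ◃ (a ≥ᶜ b) = (h ∷ᵛ a) ≥ᶜ b

Bounded-lead-rest : ∀ {n N} (c : Constraint (suc n)) → Bounded N c →
  ℤ.∣ lead c ∣ ℕ.≤ N × Bounded N (rest c)
Bounded-lead-rest (a ≥ᶜ b) (a≤N , b≤N) = a≤N zero , a≤N ∘ suc , b≤N

record Partition (n : ℕ) : Set where
  field
    lower : List (ℕ × Constraint n)
    upper : List (ℕ × Constraint n)
    free  : List (Constraint n)
open Partition

insertByLead : ∀ {n} → ℤ → Constraint n → Partition n → Partition n
insertByLead +[1+ p ] t π = record π { lower = (p , t) ∷ lower π }
insertByLead +0       t π = record π { free = t ∷ free π }
insertByLead -[1+ q ] t π = record π { upper = (q , t) ∷ upper π }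

partitionByLead : ∀ {n} → List (Constraint (suc n)) → Partition n
partitionByLead = foldr (λ c → insertByLead (lead c) (rest c))
                        (record { lower = [] ; upper = [] ; free = [] })

module _ {n} (P : ℤ → Constraint n → Set) where

  AllParts : Partition n → Set
  AllParts π = All (λ (p , t) → P +[1+ p ] t) (lower π)
             × All (λ (q , t) → P -[1+ q ] t) (upper π)
             × All (P +0) (free π)

  insertByLead⁺ : ∀ h t {π} → P h t → AllParts π → AllParts (insertByLead h t π)
  insertByLead⁺ +[1+ p ] t s (ls , us , fs) = s ∷ ls , us , fs
  insertByLead⁺ +0       t s (ls , us , fs) = ls , us , s ∷ fs
  insertByLead⁺ -[1+ q ] t s (ls , us , fs) = ls , s ∷ us , fs

  insertByLead⁻ : ∀ h t {π} → AllParts (insertByLead h t π) → P h t × AllParts π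
  insertByLead⁻ +[1+ p ] t (s ∷ ls , us , fs) = s , ls , us , fs
  insertByLead⁻ +0       t (ls , us , s ∷ fs) = s , ls , us , fs
  insertByLead⁻ -[1+ q ] t (ls , s ∷ us , fs) = s , ls , us , fs

  All-partitionByLead⁺ : ∀ cs → All (λ c → P (lead c) (rest c)) cs → AllParts (partitionByLead cs)
  All-partitionByLead⁺ []       []       = [] , [] , []
  All-partitionByLead⁺ (c ∷ cs) (s ∷ ss) = insertByLead⁺ (lead c) (rest c) s (All-partitionByLead⁺ cs ss)

  All-partitionByLead⁻ : ∀ cs → AllParts (partitionByLead cs) → All (λ c → P (lead c) (rest c)) cs
  All-partitionByLead⁻ []       _     = []
  All-partitionByLead⁻ (c ∷ cs) parts =
    let s , ss = insertByLead⁻ (lead c) (rest c) parts in s ∷ All-partitionByLead⁻ cs ss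

cancelLead : ∀ {n} → ℕ × Constraint n → ℕ × Constraint n → Constraint n
cancelLead (p , t₁) (q , t₂) = combine (suc q) t₁ (suc p) t₂

eliminate : ∀ {n} → List (Constraint (suc n)) → List (Constraint n)
eliminate cs = free π ++ cartesianProductWith cancelLead (lower π) (upper π)
  where π = partitionByLead cs

free-⊨[]⁻ : ∀ {n δ x₀} {y : Fin n → ℚ} t → x₀ ∷ᵛ y ⊨[ δ ] +0 ◃ t → y ⊨[ δ ] t
free-⊨[]⁻ {δ = δ} {x₀} {y} (a ≥ᶜ b) sat =
  subst (λ r → ι b ≤ r + δ) (trans (cong (_+ a · y) (*-zeroˡ x₀)) (+-identityˡ (a · y))) sat

free-⊨⁺ : ∀ {n x₀} {y : Fin n → ℚ} t → y ⊨ t → x₀ ∷ᵛ y ⊨ +0 ◃ t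
free-⊨⁺ {x₀ = x₀} {y} (a ≥ᶜ b) sat =
  subst (ι b ≤_) (sym (trans (cong (_+ a · y) (*-zeroˡ x₀)) (+-identityˡ (a · y)))) sat

cancelLead-⊨[] : ∀ {n δ x₀} {y : Fin n → ℚ} p t₁ q t₂ →
  x₀ ∷ᵛ y ⊨[ δ ] +[1+ p ] ◃ t₁ → x₀ ∷ᵛ y ⊨[ δ ] -[1+ q ] ◃ t₂ →
  y ⊨[ ι (+ (suc q ℕ.+ suc p)) * δ ] cancelLead (p , t₁) (q , t₂)
cancelLead-⊨[] {δ = δ} {x₀} {y} p (a₁ ≥ᶜ b₁) q (a₂ ≥ᶜ b₂) sat₁ sat₂ = begin
  ι (+ suc q ℤ.* b₁ ℤ.+ + suc p ℤ.* b₂)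
    ≡⟨ ι-combination (suc q) b₁ (suc p) b₂ ⟩
  Q * ι b₁ + P * ι b₂
    ≤⟨ +-mono-≤ (ι-*-monoˡ-≤ (suc q) sat₁) (ι-*-monoˡ-≤ (suc p) sat₂) ⟩
  Q * (P * x₀ + a₁ · y + δ) + P * (- Q * x₀ + a₂ · y + δ)
    ≡⟨ solve 6 (λ Q P X L₁ L₂ D → Q :* (P :* X :+ L₁ :+ D) :+ P :* ((:- Q) :* X :+ L₂ :+ D)
                                  := (Q :* L₁ :+ P :* L₂) :+ (Q :+ P) :* D)
         refl Q P x₀ (a₁ · y) (a₂ · y) δ ⟩
  (Q * (a₁ · y) + P * (a₂ · y)) + (Q + P) * δ
    ≡⟨ cong₂ _+_ (·-combine (suc q) a₁ (suc p) a₂ y) (cong (_* δ) (ι-+ (+ suc q) (+ suc p))) ⟨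
  (λ j → + suc q ℤ.* a₁ j ℤ.+ + suc p ℤ.* a₂ j) · y + ι (+ (suc q ℕ.+ suc p)) * δ ∎
  where
  open ≤-Reasoning
  P = ι (+ suc p)
  Q = ι (+ suc q)

lowerBound : ∀ {n} → (Fin n → ℚ) → ℕ × Constraint n → ℚ
lowerBound y (p , a ≥ᶜ b) = (ι b - a · y) * (+ 1 / suc p)

upperBound : ∀ {n} → (Fin n → ℚ) → ℕ × Constraint n → ℚ
upperBound y (q , a ≥ᶜ b) = (a · y - ι b) * (+ 1 / suc q)

cancelLead-⊨⇒lowerBound≤upperBound : ∀ {n} {y : Fin n → ℚ} p t₁ q t₂ →
  y ⊨ cancelLead (p , t₁) (q , t₂) → lowerBound y (p , t₁) ≤ upperBound y (q , t₂)
cancelLead-⊨⇒lowerBound≤upperBound {y = y} p (a₁ ≥ᶜ b₁) q (a₂ ≥ᶜ b₂) sat = ≤-cross-/ p q (begin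
  Q * (ι b₁ - a₁ · y)
    ≡⟨ solve 5 (λ Q P B₁ B₂ L₁ → Q :* (B₁ :- L₁) := (Q :* B₁ :+ P :* B₂) :- (Q :* L₁ :+ P :* B₂))
         refl Q P (ι b₁) (ι b₂) (a₁ · y) ⟩
  (Q * ι b₁ + P * ι b₂) - R
    ≡⟨ cong (_- R) (ι-combination (suc q) b₁ (suc p) b₂) ⟨
  ι (+ suc q ℤ.* b₁ ℤ.+ + suc p ℤ.* b₂) - R
    ≤⟨ +-monoˡ-≤ (- R) sat ⟩
  (λ j → + suc q ℤ.* a₁ j ℤ.+ + suc p ℤ.* a₂ j) · y - R
    ≡⟨ cong (_- R) (·-combine (suc q) a₁ (suc p) a₂ y) ⟩
  (Q * (a₁ · y) + P * (a₂ · y)) - R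
    ≡⟨ solve 5 (λ Q P B₂ L₁ L₂ → (Q :* L₁ :+ P :* L₂) :- (Q :* L₁ :+ P :* B₂) := P :* (L₂ :- B₂))
         refl Q P (ι b₂) (a₁ · y) (a₂ · y) ⟩
  P * (a₂ · y - ι b₂) ∎)
  where
  open ≤-Reasoning
  P = ι (+ suc p)
  Q = ι (+ suc q)
  R = Q * (a₁ · y) + P * ι b₂

lowerBound≤⇒⊨ : ∀ {n x₀} {y : Fin n → ℚ} p t → lowerBound y (p , t) ≤ x₀ → x₀ ∷ᵛ y ⊨ +[1+ p ] ◃ t
lowerBound≤⇒⊨ {x₀ = x₀} {y} p (a ≥ᶜ b) lb≤x₀ = begin
  ι b
    ≡⟨ solve 2 (λ B L → B := (B :- L) :+ L) refl (ι b) (a · y) ⟩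
  (ι b - a · y) + a · y
    ≡⟨ cong (_+ a · y) (*-/-cancel p (ι b - a · y)) ⟨
  P * lowerBound y (p , a ≥ᶜ b) + a · y
    ≤⟨ +-monoˡ-≤ (a · y) (ι-*-monoˡ-≤ (suc p) lb≤x₀) ⟩
  P * x₀ + a · y ∎
  where
  open ≤-Reasoning
  P = ι (+ suc p)

≤upperBound⇒⊨ : ∀ {n x₀} {y : Fin n → ℚ} q t → x₀ ≤ upperBound y (q , t) → x₀ ∷ᵛ y ⊨ -[1+ q ] ◃ t
≤upperBound⇒⊨ {x₀ = x₀} {y} q (a ≥ᶜ b) x₀≤ub = begin
  ι b
    ≡⟨ solve 2 (λ B L → B := (:- (L :- B)) :+ L) refl (ι b) (a · y) ⟩
  - (a · y - ι b) + a · y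
    ≡⟨ cong (λ r → - r + a · y) (*-/-cancel q (a · y - ι b)) ⟨
  - (Q * upperBound y (q , a ≥ᶜ b)) + a · y
    ≤⟨ +-monoˡ-≤ (a · y) (neg-antimono-≤ (ι-*-monoˡ-≤ (suc q) x₀≤ub)) ⟩
  - (Q * x₀) + a · y
    ≡⟨ cong (_+ a · y) (neg-distribˡ-* Q x₀) ⟩
  - Q * x₀ + a · y ∎
  where
  open ≤-Reasoning
  Q = ι (+ suc q)

n≤n*n+n*n : ∀ n → n ℕ.≤ n ℕ.* n ℕ.+ n ℕ.* n
n≤n*n+n*n zero    = z≤n
n≤n*n+n*n (suc n) = ℕ.≤-trans (ℕ.m≤m*n (suc n) (suc n)) (ℕ.m≤m+n _ _)

eliminate-bounded : ∀ {n N} (cs : List (Constraint (suc n))) → All (Bounded N) cs →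
  All (Bounded (N ℕ.* N ℕ.+ N ℕ.* N)) (eliminate cs)
eliminate-bounded {N = N} cs bnd = All.++⁺
  (All.map (λ {t} (_ , t≤N) → Bounded-mono t (n≤n*n+n*n N) t≤N) frees)
  (All.cartesianProductWith⁺ (setoid _) (setoid _) cancelLead (lower π) (upper π) pair)
  where
  π = partitionByLead cs
  P : ℤ → Constraint _ → Set
  P h t = ℤ.∣ h ∣ ℕ.≤ N × Bounded N t
  parts : AllParts P π
  parts = All-partitionByLead⁺ P cs (All.map (λ {c} → Bounded-lead-rest c) bnd)
  lowers = proj₁ parts
  uppers = proj₁ (proj₂ parts)
  frees = proj₂ (proj₂ parts)
  pair : ∀ {u v} → u ∈ lower π → v ∈ upper π → Bounded (N ℕ.* N ℕ.+ N ℕ.* N) (cancelLead u v)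
  pair {_ , t₁} {_ , t₂} u∈ v∈ =
    let p<N , t₁≤N = All.lookup lowers u∈
        q<N , t₂≤N = All.lookup uppers v∈
    in combine-bounded {c = t₁} {t₂} q<N p<N t₁≤N t₂≤N

eliminate-within : ∀ {n N δ} (cs : List (Constraint (suc n))) x → 0ℚ ≤ δ →
  All (Bounded N) cs → All (x ⊨[ δ ]_) cs →
  All (x ∘ suc ⊨[ ι (+ suc (N ℕ.+ N)) * δ ]_) (eliminate cs)
eliminate-within {N = N} {δ} cs x δ≥0 bnd sat = All.++⁺
  (All.map (λ {t} (_ , s) → ⊨[]-mono t δ≤δ′ (free-⊨[]⁻ {x₀ = x zero} t s)) frees)
  (All.cartesianProductWith⁺ (setoid _) (setoid _) cancelLead (lower π) (upper π) pair)
  where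
  π = partitionByLead cs
  δ′ = ι (+ suc (N ℕ.+ N)) * δ
  δ≤δ′ : δ ≤ δ′
  δ≤δ′ = subst (_≤ δ′) (*-identityˡ δ) (scale-mono-≤ δ≥0 {1} {suc (N ℕ.+ N)} (s≤s z≤n))
  P : ℤ → Constraint _ → Set
  P h t = ℤ.∣ h ∣ ℕ.≤ N × x zero ∷ᵛ x ∘ suc ⊨[ δ ] h ◃ t
  -- x ⊨[ δ ] c and x zero ∷ᵛ x ∘ suc ⊨[ δ ] lead c ◃ rest c unfold to the same inequality.
  parts : AllParts P π
  parts = All-partitionByLead⁺ P cs
    (All.zipWith (λ {c} (c≤N , s) → proj₁ (Bounded-lead-rest c c≤N) , s) (bnd , sat))
  lowers = proj₁ parts
  uppers = proj₁ (proj₂ parts)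
  frees = proj₂ (proj₂ parts)
  pair : ∀ {u v} → u ∈ lower π → v ∈ upper π → x ∘ suc ⊨[ δ′ ] cancelLead u v
  pair {p , t₁} {q , t₂} u∈ v∈ =
    let p<N , s₁ = All.lookup lowers u∈
        q<N , s₂ = All.lookup uppers v∈
    in ⊨[]-mono (cancelLead (p , t₁) (q , t₂))
         (scale-mono-≤ δ≥0 (ℕ.m≤n⇒m≤1+n (ℕ.+-mono-≤ q<N p<N)))
         (cancelLead-⊨[] p t₁ q t₂ s₁ s₂)

eliminate-complete : ∀ {n} (cs : List (Constraint (suc n))) y → All (y ⊨_) (eliminate cs) →
  ∃[ x₀ ] All (x₀ ∷ᵛ y ⊨_) cs
eliminate-complete cs y sat =
  x₀ , All-partitionByLead⁻ (λ h t → x₀ ∷ᵛ y ⊨ h ◃ t) cs (lowers , uppers , frees)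
  where
  π = partitionByLead cs
  compatible : All (λ l → All (l ≤_) (map (upperBound y) (upper π))) (map (lowerBound y) (lower π))
  compatible = All.map⁺ (All.tabulate λ {(p , t₁)} u∈ → All.map⁺ (All.tabulate λ {(q , t₂)} v∈ →
    cancelLead-⊨⇒lowerBound≤upperBound p t₁ q t₂
      (All.lookup (All.++⁻ʳ (free π) sat) (∈-cartesianProductWith⁺ cancelLead u∈ v∈))))
  between = ∃-between _ _ compatible
  x₀ = proj₁ between
  lowers = All.map (λ {(p , t)} → lowerBound≤⇒⊨ p t) (All.map⁻ (proj₁ (proj₂ between)))
  uppers = All.map (λ {(q , t)} → ≤upperBound⇒⊨ q t) (All.map⁻ (proj₂ (proj₂ between)))
  frees = All.map (λ {t} → free-⊨⁺ {x₀ = x₀} t) (All.++⁻ˡ (free π) sat)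

gapFactor : ℕ → ℕ → ℕ
gapFactor zero    N = 1
gapFactor (suc n) N = suc (N ℕ.+ N) ℕ.* gapFactor n (N ℕ.* N ℕ.+ N ℕ.* N)

gapFactor-monoʳ : ∀ n {N M} → N ℕ.≤ M → gapFactor n N ℕ.≤ gapFactor n M
gapFactor-monoʳ zero    N≤M = ℕ.≤-refl
gapFactor-monoʳ (suc n) N≤M = ℕ.*-mono-≤ (s≤s (ℕ.+-mono-≤ N≤M N≤M))
  (gapFactor-monoʳ n (ℕ.+-mono-≤ (ℕ.*-mono-≤ N≤M N≤M) (ℕ.*-mono-≤ N≤M N≤M)))

gapFactor-monoˡ : ∀ N {m n} → m ℕ.≤ n → gapFactor m N ℕ.≤ gapFactor n N
gapFactor-monoˡ N {n = zero}  z≤n = ℕ.≤-refl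
gapFactor-monoˡ N {m} {suc n} m≤1+n with ℕ.m≤n⇒m<n∨m≡n m≤1+n
... | inj₂ refl     = ℕ.≤-refl
... | inj₁ m<1+n    = ℕ.≤-trans (gapFactor-monoˡ N (ℕ.≤-pred m<1+n)) (ℕ.≤-trans
  (gapFactor-monoʳ n (n≤n*n+n*n N)) (ℕ.m≤n*m _ (suc (N ℕ.+ N))))

nearly-satisfiable⇒satisfiable : ∀ {n} N {δ} (cs : List (Constraint n)) → All (Bounded N) cs →
  0ℚ ≤ δ → δ * ι (+ gapFactor n N) < 1ℚ → ∀ x → All (x ⊨[ δ ]_) cs → ∃[ y ] All (y ⊨_) cs
nearly-satisfiable⇒satisfiable {zero} N {δ} _ _ _ δ<1 x sat = x , All.map (λ {c} → integral c) sat
  where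
  integral : ∀ c → x ⊨[ δ ] c → x ⊨ c
  integral (a ≥ᶜ b) s =
    ι<1⇒ι≤0 b (≤-<-trans s (subst (_< 1ℚ) (trans (*-identityʳ δ) (sym (+-identityˡ δ))) δ<1))
nearly-satisfiable⇒satisfiable {suc n} N {δ} cs bnd δ≥0 δG<1 x sat =
  let y , y⊨ = nearly-satisfiable⇒satisfiable N′ (eliminate cs) (eliminate-bounded cs bnd)
                 δ′≥0 δ′G′<1 (x ∘ suc) (eliminate-within cs x δ≥0 bnd sat)
      x₀ , x₀∷y⊨ = eliminate-complete cs y y⊨
  in x₀ ∷ᵛ y , x₀∷y⊨
  where
  K = suc (N ℕ.+ N)
  N′ = N ℕ.* N ℕ.+ N ℕ.* N
  G′ = gapFactor n N′
  δ′ = ι (+ K) * δ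
  δ′≥0 : 0ℚ ≤ δ′
  δ′≥0 = nonNegative⁻¹ δ′ {{nonNeg*nonNeg⇒nonNeg (ι (+ K)) {{ι-nonNeg K}} δ {{ℚ.nonNegative δ≥0}}}}
  δ′G′<1 : δ′ * ι (+ G′) < 1ℚ
  δ′G′<1 = subst (_< 1ℚ) (begin
    δ * ι (+ (K ℕ.* G′))       ≡⟨ cong (λ i → δ * ι i) (ℤ.pos-* K G′) ⟩
    δ * ι (+ K ℤ.* + G′)       ≡⟨ cong (δ *_) (ι-* (+ K) (+ G′)) ⟩
    δ * (ι (+ K) * ι (+ G′))   ≡⟨ solve 3 (λ D K G → D :* (K :* G) := K :* D :* G)
                                      refl δ (ι (+ K)) (ι (+ G′)) ⟩
    δ′ * ι (+ G′)              ∎) δG<1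
    where open ≡-Reasoning

-- Unary linear programs as constraint systems

basis : ∀ {n} → Fin n → Fin n → ℤ
basis zero    zero    = + 1
basis zero    (suc _) = +0
basis (suc _) zero    = +0
basis (suc i) (suc j) = basis i j

∣basis∣≤1 : ∀ {n} (i j : Fin n) → ℤ.∣ basis i j ∣ ℕ.≤ 1
∣basis∣≤1 zero    zero    = ℕ.≤-refl
∣basis∣≤1 zero    (suc _) = z≤n
∣basis∣≤1 (suc _) zero    = z≤n
∣basis∣≤1 (suc i) (suc j) = ∣basis∣≤1 i j

·-const : ∀ {n} i (x : Fin n → ℚ) → (λ _ → i) · x ≡ ι i * Σᶠ n x
·-const {n} i x = sym (*-distribˡ-Σᶠ n (ι i) x)

·-basis : ∀ {n} (i : Fin n) x → basis i · x ≡ x i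
·-basis {suc n} zero x = begin
  1ℚ * x zero + (λ _ → +0) · (x ∘ suc)
    ≡⟨ cong₂ _+_ (*-identityˡ (x zero)) (trans (·-const +0 (x ∘ suc)) (*-zeroˡ (Σᶠ n (x ∘ suc)))) ⟩
  x zero + 0ℚ
    ≡⟨ +-identityʳ (x zero) ⟩
  x zero ∎
  where open ≡-Reasoning
·-basis {suc n} (suc i) x = begin
  0ℚ * x zero + basis i · (x ∘ suc)  ≡⟨ cong₂ _+_ (*-zeroˡ (x zero)) (·-basis i (x ∘ suc)) ⟩
  0ℚ + x (suc i)                     ≡⟨ +-identityˡ (x (suc i)) ⟩
  x (suc i)                          ∎
  where open ≡-Reasoning

bitℤ : Bool → ℤ
bitℤ true  = + 1
bitℤ false = +0

·-bits : ∀ {n} (f : Fin n → Bool) x → (λ j → bitℤ (f j)) · x ≡ Σᶠ n (λ j → bit (f j) * x j)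
·-bits {n} f x = Σᶠ-cong n (λ j → cong (_* x j) (ι-bitℤ (f j)))
  where
  ι-bitℤ : ∀ b → ι (bitℤ b) ≡ bit b
  ι-bitℤ true  = refl
  ι-bitℤ false = refl

·-neg-ones : ∀ {n} (x : Fin n → ℚ) → (λ _ → -1ℤ) · x ≡ - Σᶠ n x
·-neg-ones {n} x = begin
  (λ _ → -1ℤ) · x     ≡⟨ ·-const -1ℤ x ⟩
  ι -1ℤ * Σᶠ n x      ≡⟨ neg-distribˡ-* 1ℚ (Σᶠ n x) ⟨
  - (1ℚ * Σᶠ n x)     ≡⟨ cong -_ (*-identityˡ (Σᶠ n x)) ⟩
  - Σᶠ n x            ∎
  where open ≡-Reasoning

objectiveAtMost : ∀ {n} → ℕ → Constraint n
objectiveAtMost k = (λ _ → -1ℤ) ≥ᶜ ℤ.- + k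

objectiveAtMost-⊨[]⁺ : ∀ {n} k {δ} (x : Fin n → ℚ) → objective x ≤ ι (+ k) + δ →
  x ⊨[ δ ] objectiveAtMost k
objectiveAtMost-⊨[]⁺ {n} k {δ} x obj≤k+δ = begin
  ι (ℤ.- + k)            ≡⟨ ι-neg k ⟩
  - ι (+ k)              ≡⟨ solve 2 (λ K D → :- K := :- (K :+ D) :+ D) refl (ι (+ k)) δ ⟩
  - (ι (+ k) + δ) + δ    ≤⟨ +-monoˡ-≤ δ (neg-antimono-≤ obj≤k+δ) ⟩
  - Σᶠ n x + δ           ≡⟨ cong (_+ δ) (·-neg-ones x) ⟨
  (λ _ → -1ℤ) · x + δ    ∎
  where open ≤-Reasoning

objectiveAtMost-⊨⁻ : ∀ {n} k (x : Fin n → ℚ) → x ⊨ objectiveAtMost k → objective x ≤ ι (+ k)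
objectiveAtMost-⊨⁻ {n} k x sat = begin
  Σᶠ n x        ≡⟨ ⁻¹-involutive (Σᶠ n x) ⟨
  - - Σᶠ n x    ≤⟨ neg-antimono-≤ (subst₂ _≤_ (ι-neg k) (·-neg-ones x) sat) ⟩
  - - ι (+ k)   ≡⟨ ⁻¹-involutive (ι (+ k)) ⟩
  ι (+ k)       ∎
  where open ≤-Reasoning

rowConstraint : ∀ {n} (Z : UnaryLP n) → Fin (m Z) → Constraint n
rowConstraint Z i = (λ j → bitℤ (A Z i j)) ≥ᶜ + 1

nonNegConstraint : ∀ {n} → Fin n → Constraint n
nonNegConstraint j = basis j ≥ᶜ +0

system : ∀ {n} → UnaryLP n → ℕ → List (Constraint n)
system Z k = objectiveAtMost k ∷ tabulate (rowConstraint Z) ++ tabulate nonNegConstraint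

system-bounded : ∀ {n k} (Z : UnaryLP n) → 1 ℕ.≤ k → All (Bounded k) (system Z k)
system-bounded {k = k} Z 1≤k =
  ((λ _ → 1≤k) , ℕ.≤-reflexive (ℤ.∣-i∣≡∣i∣ (+ k)))
  ∷ All.++⁺ (All.tabulate⁺ (λ i → (λ j → ℕ.≤-trans (∣bitℤ∣≤1 (A Z i j)) 1≤k) , 1≤k))
            (All.tabulate⁺ (λ i → (λ j → ℕ.≤-trans (∣basis∣≤1 i j) 1≤k) , z≤n))
  where
  ∣bitℤ∣≤1 : ∀ b → ℤ.∣ bitℤ b ∣ ℕ.≤ 1
  ∣bitℤ∣≤1 true  = ℕ.≤-refl
  ∣bitℤ∣≤1 false = z≤n

system-⊨[]⁺ : ∀ {n k δ} (Z : UnaryLP n) {x} → Feasible Z x → 0ℚ ≤ δ → objective x ≤ ι (+ k) + δ →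
  All (x ⊨[ δ ]_) (system Z k)
system-⊨[]⁺ {k = k} Z {x} (x≥0 , rows≥1) δ≥0 obj≤k+δ = objectiveAtMost-⊨[]⁺ k x obj≤k+δ
  ∷ All.++⁺ (All.tabulate⁺ λ i → ⊨⇒⊨[] (rowConstraint Z i) δ≥0
                                   (subst (1ℚ ≤_) (sym (·-bits (A Z i) x)) (rows≥1 i)))
            (All.tabulate⁺ λ j → ⊨⇒⊨[] (nonNegConstraint j) δ≥0
                                   (subst (0ℚ ≤_) (sym (·-basis j x)) (x≥0 j)))

system-⊨⁻ : ∀ {n k} (Z : UnaryLP n) {y} → All (y ⊨_) (system Z k) → Feasible Z y × objective y ≤ ι (+ k)
system-⊨⁻ {k = k} Z {y} (obj ∷ rows+nonNeg) =
  ( (λ j → subst (0ℚ ≤_) (·-basis j y) (All.tabulate⁻ nonNeg j))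
  , (λ i → subst (1ℚ ≤_) (·-bits (A Z i) y) (All.tabulate⁻ rows i)) )
  , objectiveAtMost-⊨⁻ k y obj
  where
  rows = All.++⁻ˡ (tabulate (rowConstraint Z)) rows+nonNeg
  nonNeg = All.++⁻ʳ (tabulate (rowConstraint Z)) rows+nonNeg

OPT≤k+δ⇒OPT≤k : ∀ {n k δ v} (Z : UnaryLP n) → IsOPT Z v → 1 ℕ.≤ k → 0ℚ ≤ δ →
  δ * ι (+ gapFactor n k) < 1ℚ → v ≤ ι (+ k) + δ → v ≤ ι (+ k)
OPT≤k+δ⇒OPT≤k {k = k} Z ((x , x-feasible , objx≡v) , v-minimal) 1≤k δ≥0 δG<1 v≤k+δ =
  let y , y⊨ = nearly-satisfiable⇒satisfiable k (system Z k) (system-bounded Z 1≤k) δ≥0 δG<1 x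
                 (system-⊨[]⁺ Z x-feasible δ≥0 (subst (_≤ ι (+ k) + _) (sym objx≡v) v≤k+δ))
      y-feasible , objy≤k = system-⊨⁻ Z y⊨
  in ≤-trans (v-minimal y y-feasible) objy≤k

lemma2p2 : (n k : ℕ) → 1 ℕ.≤ n → 1 ℕ.≤ k →
    Σ ℕ (λ d →
      (n′ : ℕ) → n′ ℕ.≤ n → (Z : UnaryLP n′) → (v : ℚ) → IsOPT Z v →
        (+ k / 1) < v → (+ 1 / suc d) < (v - (+ k / 1)))
lemma2p2 n k _ 1≤k = gapFactor n k , gap
  where
  δ = + 1 / suc (gapFactor n k)
  δ≥0 : 0ℚ ≤ δ
  δ≥0 = nonNegative⁻¹ δ {{normalize-nonNeg 1 (suc (gapFactor n k))}}
  gap : (n′ : ℕ) → n′ ℕ.≤ n → (Z : UnaryLP n′) → (v : ℚ) → IsOPT Z v →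
    ι (+ k) < v → δ < v - ι (+ k)
  gap n′ n′≤n Z v opt k<v = ≰⇒> λ v-k≤δ → <-irrefl refl (<-≤-trans k<v
    (OPT≤k+δ⇒OPT≤k Z opt 1≤k δ≥0 (1/[1+d]*m<1 (gapFactor-monoˡ k n′≤n)) (p-q≤r⇒p≤q+r v-k≤δ)))
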